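{- Let $m = p_1^{e_1}\cdots p_r^{e_r}$ with $p_1, \ldots, p_r$ distinct primes and $r \ge 1$. Then the sequential power graph of $\mathbb{Z}/m\mathbb{Z}$ has exactly $2^r$ connected components.
   Context: The sequential power graph of $\mathbb{Z}/m\mathbb{Z}$ is the directed graph with vertex set $\mathbb{Z}/m\mathbb{Z}$ and an edge $(b,c)$ if and only if there exist $a \in \mathbb{Z}/m\mathbb{Z}$ and $i \in \mathbb{N}$ with $b \equiv a^i$ and $c \equiv a^{i+1} \pmod m$. A connected component is a maximal set of vertices any two of which are joined by an undirected path. -}

module Defs where

open import Data.Nat using (ℕ; zero; suc; _*_; _^_; _≤_; NonZero)
open import Data.Nat.DivMod using (_%_)
open import Data.Fin using (Fin; toℕ)
import Data.Fin as F
open import Data.Product using (Σ; ∃; _×_; _,_)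
open import Function.Definitions using (Surjective)
open import Function.Bundles using (_⇔_)
open import Relation.Binary.PropositionalEquality using (_≡_)
open import Relation.Binary.Construct.Closure.Equivalence using (EqClosure)

∏ : (r : ℕ) → (Fin r → ℕ) → ℕ
∏ zero    f = 1
∏ (suc r) f = f F.zero * ∏ r (λ i → f (F.suc i))

-- Edge (b , c) of the sequential power graph of ℤ/mℤ (vertices = Fin m,
-- residues 0..m-1): ∃ a ∈ ℤ/mℤ, i ∈ ℕ = {1,2,...} with b ≡ a^i, c ≡ a^(i+1) (mod m).
SeqPowEdge : (m : ℕ) .{{_ : NonZero m}} → Fin m → Fin m → Set
SeqPowEdge m b c =
  ∃ λ (a : Fin m) → ∃ λ (i : ℕ) →
    (1 ≤ i) × (toℕ b ≡ (toℕ a ^ i) % m) × (toℕ c ≡ (toℕ a ^ suc i) % m)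

Connected : (m : ℕ) .{{_ : NonZero m}} → Fin m → Fin m → Set
Connected m = EqClosure (SeqPowEdge m)

-- The graph has exactly k connected components: there is a surjection from
-- the vertices onto Fin k whose fibres are precisely the components
-- (i.e. a bijection between the set of components and Fin k).
HasExactlyComponents : (m : ℕ) .{{_ : NonZero m}} → ℕ → Set
HasExactlyComponents m k =
  Σ (Fin m → Fin k) λ f →
    Surjective _≡_ _≡_ f × (∀ x y → (f x ≡ f y) ⇔ Connected m x y)

module Submission where

-- To a residue x attach its divisibility pattern: the set of i with
-- p_i ∣ x, encoded as a number below 2^r.
--  * Along an edge a^i — a^(i+1) the pattern is constant, because a prime
--    divides a positive power of a iff it divides a; hence the pattern is
--    constant on components.
--  * Conversely, let K = m!.  Every vertex x is joined to x^K by the path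
--    x — x² — ⋯ — x^K.  Modulo p_i^e_i the power x^K is 0 when p_i ∣ x and 1
--    otherwise (orders of units mod p^e are at most p^e ≤ m, hence divide K),
--    so by the Chinese remainder theorem x^K mod m depends only on the
--    pattern: vertices with equal patterns are connected.
--  * Every pattern occurs: the product of the selected primes realises it.

open import Defs
open import Data.Nat using (ℕ; zero; suc; _+_; _*_; _∸_; _^_; _≤_; _<_; NonZero; z≤n; s≤s; z<s; _!; nonTrivial⇒n>1; ≢-nonZero)
open import Data.Nat.Properties
open import Data.Nat.DivMod
open import Data.Nat.Divisibility
open import Data.Nat.Primality using (Prime; prime; euclidsLemma; prime⇒irreducible; prime⇒nonZero)
open import Data.Fin using (Fin; toℕ; fromℕ<; funToFin; finToFun)
import Data.Fin as F
import Data.Fin.Properties as FP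
open import Data.Product using (∃; ∃₂; _×_; _,_)
open import Data.Sum using (inj₁; inj₂)
open import Data.Empty using (⊥-elim)
open import Function using (_∘_)
open import Function.Definitions using (Injective; Surjective)
open import Function.Bundles using (_⇔_; mk⇔; Equivalence)
open import Function.Construct.Symmetry using (⇔-sym)
open import Function.Construct.Composition using (_⇔-∘_)
open import Relation.Nullary using (¬_; Dec; yes; no)
open import Relation.Binary.PropositionalEquality
import Relation.Binary.Construct.Closure.Equivalence as Closure

open Equivalence using (to; from)

prime>1 : ∀ {p} → Prime p → 1 < p
prime>1 {p} (prime _) = nonTrivial⇒n>1 p

prime∤1 : ∀ {p} → Prime p → ¬ p ∣ 1
prime∤1 pp p∣1 = <-irrefl (sym (∣1⇒≡1 p∣1)) (prime>1 pp)

prime∣^⇒∣ : ∀ {p} → Prime p → ∀ a k → p ∣ a ^ k → p ∣ a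
prime∣^⇒∣ pp a zero    p∣1 = ⊥-elim (prime∤1 pp p∣1)
prime∣^⇒∣ pp a (suc k) p∣aᵏ⁺¹ with euclidsLemma a (a ^ k) pp p∣aᵏ⁺¹
... | inj₁ p∣a  = p∣a
... | inj₂ p∣aᵏ = prime∣^⇒∣ pp a k p∣aᵏ

prime∣^⇒exponent≥1 : ∀ {p} → Prime p → ∀ a k → p ∣ a ^ k → 1 ≤ k
prime∣^⇒exponent≥1 pp a zero    p∣1 = ⊥-elim (prime∤1 pp p∣1)
prime∣^⇒exponent≥1 pp a (suc k) _   = s≤s z≤n

∣⇒∣^ : ∀ {d} a k → 1 ≤ k → d ∣ a → d ∣ a ^ k
∣⇒∣^ a (suc k) _ d∣a = ∣m⇒∣m*n (a ^ k) d∣a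

^-mono-∣ : ∀ {a b} k → a ∣ b → a ^ k ∣ b ^ k
^-mono-∣ zero    _   = ∣-refl
^-mono-∣ (suc k) a∣b = *-pres-∣ a∣b (^-mono-∣ k a∣b)

prime∣prime⇒≡ : ∀ {q p} → Prime q → Prime p → q ∣ p → q ≡ p
prime∣prime⇒≡ pq pp q∣p with prime⇒irreducible pp q∣p
... | inj₁ q≡1 = ⊥-elim (prime∤1 pq (subst (_∣ 1) (sym q≡1) ∣-refl))
... | inj₂ q≡p = q≡p

factor∣∏ : ∀ r (h : Fin r → ℕ) j → h j ∣ ∏ r h
factor∣∏ (suc r) h F.zero    = m∣m*n _
factor∣∏ (suc r) h (F.suc j) = ∣n⇒∣m*n (h F.zero) (factor∣∏ r (h ∘ F.suc) j)

prime∣∏ : ∀ {q} → Prime q → ∀ r (h : Fin r → ℕ) → q ∣ ∏ r h → ∃ λ j → q ∣ h j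
prime∣∏ pq zero    h q∣1 = ⊥-elim (prime∤1 pq q∣1)
prime∣∏ pq (suc r) h q∣∏ with euclidsLemma (h F.zero) (∏ r (h ∘ F.suc)) pq q∣∏
... | inj₁ q∣h₀ = F.zero , q∣h₀
... | inj₂ q∣∏' with prime∣∏ pq r (h ∘ F.suc) q∣∏'
...   | j , q∣hⱼ = F.suc j , q∣hⱼ

prime-power-cancel : ∀ {p N} → Prime p → ¬ p ∣ N → ∀ e w → p ^ e ∣ N * w → p ^ e ∣ w
prime-power-cancel pp p∤N zero    w _ = 1∣ w
prime-power-cancel {p} {N} pp p∤N (suc e) w pᵉ⁺¹∣Nw
  with euclidsLemma N w pp (∣-trans (m∣m*n (p ^ e)) pᵉ⁺¹∣Nw)
... | inj₁ p∣N = ⊥-elim (p∤N p∣N)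
... | inj₂ (divides w' refl) = subst (_∣ w' * p) (*-comm (p ^ e) p) (*-monoˡ-∣ p pᵉ∣w')
  where
  instance _ = prime⇒nonZero pp
  pᵉ∣w' : p ^ e ∣ w'
  pᵉ∣w' = prime-power-cancel pp p∤N e w' (*-cancelʳ-∣ p
    (subst₂ _∣_ (*-comm p (p ^ e)) (sym (*-assoc N w' p)) pᵉ⁺¹∣Nw))

prime-power-index : ∀ {r} (p : Fin r → ℕ) → (∀ i → Prime (p i)) → Injective _≡_ _≡_ p →
                    ∀ {i j} k → p i ∣ p j ^ k → i ≡ j
prime-power-index p pr inj {i} {j} k pᵢ∣pⱼᵏ =
  inj (prime∣prime⇒≡ (pr i) (pr j) (prime∣^⇒∣ (pr i) (p j) k pᵢ∣pⱼᵏ))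

prime-powers-∏-∣ : ∀ r (p e : Fin r → ℕ) → (∀ i → Prime (p i)) → Injective _≡_ _≡_ p →
                   ∀ c → (∀ i → p i ^ e i ∣ c) → ∏ r (λ i → p i ^ e i) ∣ c
prime-powers-∏-∣ zero    p e _  _   c _ = 1∣ c
prime-powers-∏-∣ (suc r) p e pr inj c divs
  with prime-powers-∏-∣ r (p ∘ F.suc) (e ∘ F.suc) (pr ∘ F.suc)
                        (λ eq → FP.suc-injective (inj eq)) c (divs ∘ F.suc)
... | divides k refl = *-monoˡ-∣ R P₀∣k
  where
  R = ∏ r (λ i → p (F.suc i) ^ e (F.suc i))
  p₀∤R : ¬ p F.zero ∣ R
  p₀∤R p₀∣R with prime∣∏ (pr F.zero) r _ p₀∣R
  ... | j , p₀∣pⱼᵉ with prime-power-index p pr inj (e (F.suc j)) p₀∣pⱼᵉ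
  ...   | ()
  P₀∣k : p F.zero ^ e F.zero ∣ k
  P₀∣k = prime-power-cancel (pr F.zero) p₀∤R (e F.zero) k
           (subst (p F.zero ^ e F.zero ∣_) (*-comm k R) (divs F.zero))

%≡%⇒∣∸ : ∀ n .{{_ : NonZero n}} a b → a % n ≡ b % n → n ∣ b ∸ a
%≡%⇒∣∸ n a b a≡b = divides (b / n ∸ a / n) (begin
    b ∸ a                                     ≡⟨ cong₂ _∸_ (m≡m%n+[m/n]*n b n) (m≡m%n+[m/n]*n a n) ⟩
    (b % n + b / n * n) ∸ (a % n + a / n * n) ≡⟨ cong (λ t → (b % n + b / n * n) ∸ (t + a / n * n)) a≡b ⟩
    (b % n + b / n * n) ∸ (b % n + a / n * n) ≡⟨ [m+n]∸[m+o]≡n∸o (b % n) _ _ ⟩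
    b / n * n ∸ a / n * n                     ≡⟨ *-distribʳ-∸ n (b / n) (a / n) ⟨
    (b / n ∸ a / n) * n                       ∎)
  where open ≡-Reasoning

∣∸⇒%≡% : ∀ n .{{_ : NonZero n}} a b → a ≤ b → n ∣ b ∸ a → a % n ≡ b % n
∣∸⇒%≡% n a b a≤b (divides k b∸a≡kn) = sym (begin
    b % n                ≡⟨ cong (_% n) (m+[n∸m]≡n a≤b) ⟨
    (a + (b ∸ a)) % n    ≡⟨ cong (λ t → (a + t) % n) b∸a≡kn ⟩
    (a + k * n) % n      ≡⟨ [m+kn]%n≡m%n a k n ⟩
    a % n                ∎)
  where open ≡-Reasoning

%≡%-lift : ∀ {r} n .{{_ : NonZero n}} (d : Fin r → ℕ) (nz : ∀ i → NonZero (d i)) →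
           (∀ c → (∀ i → d i ∣ c) → n ∣ c) →
           ∀ a b → (∀ i → (a % d i) {{nz i}} ≡ (b % d i) {{nz i}}) → a % n ≡ b % n
%≡%-lift n d nz common a b a≡b with ≤-total a b
... | inj₁ a≤b = ∣∸⇒%≡% n a b a≤b (common _ λ i → %≡%⇒∣∸ (d i) {{nz i}} a b (a≡b i))
... | inj₂ b≤a = sym (∣∸⇒%≡% n b a b≤a (common _ λ i → %≡%⇒∣∸ (d i) {{nz i}} b a (sym (a≡b i))))

^-%≡1 : ∀ n .{{_ : NonZero n}} x t → x % n ≡ 1 % n → (x ^ t) % n ≡ 1 % n
^-%≡1 n x zero    _    = refl
^-%≡1 n x (suc t) x≡1 = begin
    (x * x ^ t) % n                  ≡⟨ %-distribˡ-* x (x ^ t) n ⟩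
    ((x % n) * (x ^ t % n)) % n      ≡⟨ cong₂ (λ a b → (a * b) % n) x≡1 (^-%≡1 n x t x≡1) ⟩
    ((1 % n) * (1 % n)) % n          ≡⟨ %-distribˡ-* 1 1 n ⟨
    1 % n                            ∎
  where open ≡-Reasoning

-- Orders of units modulo a prime power

powers-repeat : ∀ n .{{_ : NonZero n}} u →
                ∃₂ λ i j → i < j × j ≤ n × (u ^ i) % n ≡ (u ^ j) % n
powers-repeat n u with FP.pigeonhole (n<1+n n) residue
  where residue : Fin (suc n) → Fin n
        residue j = fromℕ< (m%n<n (u ^ toℕ j) n)
... | i , j , i<j , same =
  toℕ i , toℕ j , i<j , FP.toℕ≤pred[n] j ,
  trans (sym (FP.toℕ-fromℕ< _)) (trans (cong toℕ same) (FP.toℕ-fromℕ< _))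

^-∸-factor : ∀ u {i j} → i ≤ j → u ^ j ∸ u ^ i ≡ u ^ i * (u ^ (j ∸ i) ∸ 1)
^-∸-factor u {i} {j} i≤j = begin
    u ^ j ∸ u ^ i                      ≡⟨ cong (λ t → u ^ t ∸ u ^ i) (m+[n∸m]≡n i≤j) ⟨
    u ^ (i + (j ∸ i)) ∸ u ^ i          ≡⟨ cong₂ _∸_ (^-distribˡ-+-* u i (j ∸ i)) (sym (*-identityʳ (u ^ i))) ⟩
    u ^ i * u ^ (j ∸ i) ∸ u ^ i * 1    ≡⟨ *-distribˡ-∸ (u ^ i) (u ^ (j ∸ i)) 1 ⟨
    u ^ i * (u ^ (j ∸ i) ∸ 1)          ∎
  where open ≡-Reasoning

unit-order : ∀ {p} → Prime p → ∀ e .{{_ : NonZero (p ^ e)}} u → ¬ p ∣ u →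
             ∃ λ d → 1 ≤ d × d ≤ p ^ e × (u ^ d) % (p ^ e) ≡ 1 % (p ^ e)
unit-order {p} pp e u p∤u with powers-repeat (p ^ e) u
... | i , j , i<j , j≤pᵉ , uⁱ≡uʲ =
  j ∸ i , m<n⇒0<n∸m i<j , ≤-trans (m∸n≤m j i) j≤pᵉ ,
  sym (∣∸⇒%≡% (p ^ e) 1 (u ^ (j ∸ i)) (m^n>0 u {{u≢0}} (j ∸ i)) pᵉ∣uᵈ∸1)
  where
  u≢0 : NonZero u
  u≢0 = ≢-nonZero (λ u≡0 → p∤u (subst (p ∣_) (sym u≡0) (p ∣0)))
  pᵉ∣uᵈ∸1 : p ^ e ∣ u ^ (j ∸ i) ∸ 1
  pᵉ∣uᵈ∸1 = prime-power-cancel pp (p∤u ∘ prime∣^⇒∣ pp u i) e _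
              (subst (p ^ e ∣_) (^-∸-factor u (<⇒≤ i<j)) (%≡%⇒∣∸ (p ^ e) _ _ uⁱ≡uʲ))

∣! : ∀ d N → 1 ≤ d → d ≤ N → d ∣ N !
∣! (suc d) N _ d<N = ∣-trans (m∣m*n (d !)) (m≤n⇒m!∣n! d<N)

n<m^n : ∀ m → 1 < m → ∀ n → n < m ^ n
n<m^n m 1<m zero    = s≤s z≤n
n<m^n m 1<m (suc n) = begin-strict
    suc n             ≤⟨ n<m^n m 1<m n ⟩
    m ^ n             <⟨ m<m+n (m ^ n) (m^n>0 m {{mNZ}} n) ⟩
    m ^ n + m ^ n     ≡⟨ cong (m ^ n +_) (+-identityʳ (m ^ n)) ⟨
    2 * m ^ n         ≤⟨ *-monoˡ-≤ (m ^ n) 1<m ⟩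
    m * m ^ n         ∎
  where open ≤-Reasoning
        mNZ : NonZero m
        mNZ = ≢-nonZero λ { refl → <-irrefl refl (<-trans z<s 1<m) }

module FactorialPower {p} (pp : Prime p) (e N : ℕ) .{{_ : NonZero (p ^ e)}} (pᵉ≤N : p ^ e ≤ N) where

  1≤pᵉ : 1 ≤ p ^ e
  1≤pᵉ = m^n>0 p {{prime⇒nonZero pp}} e

  e≤N! : e ≤ N !
  e≤N! = begin
    e     ≤⟨ <⇒≤ (n<m^n p (prime>1 pp) e) ⟩
    p ^ e ≤⟨ pᵉ≤N ⟩
    N     ≤⟨ ∣⇒≤ {{N !≢0}} (∣! N N (≤-trans 1≤pᵉ pᵉ≤N) ≤-refl) ⟩
    N !   ∎
    where open ≤-Reasoning

  multiple : ∀ u → p ∣ u → (u ^ (N !)) % (p ^ e) ≡ 0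
  multiple u p∣u = n∣m⇒m%n≡0 _ _ (subst (p ^ e ∣_) uᴺ!≡
                     (∣m⇒∣m*n (u ^ (N ! ∸ e)) (^-mono-∣ e p∣u)))
    where
    uᴺ!≡ : u ^ e * u ^ (N ! ∸ e) ≡ u ^ (N !)
    uᴺ!≡ = trans (sym (^-distribˡ-+-* u e (N ! ∸ e))) (cong (u ^_) (m+[n∸m]≡n e≤N!))

  unit : ∀ u → ¬ p ∣ u → (u ^ (N !)) % (p ^ e) ≡ 1 % (p ^ e)
  unit u p∤u with unit-order pp e u p∤u
  ... | d , 1≤d , d≤pᵉ , uᵈ≡1 with ∣! d N 1≤d (≤-trans d≤pᵉ pᵉ≤N)
  ...   | divides t N!≡td =
    subst (λ x → x % (p ^ e) ≡ 1 % (p ^ e)) (sym uᴺ!≡) (^-%≡1 (p ^ e) (u ^ d) t uᵈ≡1)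
    where
    uᴺ!≡ : u ^ (N !) ≡ (u ^ d) ^ t
    uᴺ!≡ = trans (cong (u ^_) (trans N!≡td (*-comm t d))) (sym (^-*-assoc u d t))

  determined : ∀ u v → (p ∣ u ⇔ p ∣ v) → (u ^ (N !)) % (p ^ e) ≡ (v ^ (N !)) % (p ^ e)
  determined u v p∣u⇔p∣v with p ∣? u
  ... | yes p∣u = trans (multiple u p∣u) (sym (multiple v (to p∣u⇔p∣v p∣u)))
  ... | no  p∤u = trans (unit u p∤u) (sym (unit v (p∤u ∘ from p∣u⇔p∣v)))

-- Encoding divisibility patterns as numbers below 2^r

bit : ∀ {A : Set} → Dec A → Fin 2
bit (yes _) = F.suc F.zero
bit (no _)  = F.zero

bit-cong : ∀ {A B : Set} (a? : Dec A) (b? : Dec B) → A ⇔ B → bit a? ≡ bit b?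
bit-cong (yes _) (yes _) _   = refl
bit-cong (yes a) (no ¬b) a⇔b = ⊥-elim (¬b (to a⇔b a))
bit-cong (no ¬a) (yes b) a⇔b = ⊥-elim (¬a (from a⇔b b))
bit-cong (no _)  (no _)  _   = refl

bit-injective : ∀ {A B : Set} (a? : Dec A) (b? : Dec B) → bit a? ≡ bit b? → A ⇔ B
bit-injective (yes a) (yes b) _  = mk⇔ (λ _ → b) (λ _ → a)
bit-injective (no ¬a) (no ¬b) _  = mk⇔ (⊥-elim ∘ ¬a) (⊥-elim ∘ ¬b)
bit-injective (yes _) (no _)  ()
bit-injective (no _)  (yes _) ()

bit-spec : ∀ {A : Set} (a? : Dec A) (k : Fin 2) → A ⇔ (1 ≤ toℕ k) → bit a? ≡ k
bit-spec (yes a) F.zero         a⇔k with to a⇔k a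
... | ()
bit-spec (yes _) (F.suc F.zero) _   = refl
bit-spec (no _)  F.zero         _   = refl
bit-spec (no ¬a) (F.suc F.zero) a⇔k = ⊥-elim (¬a (from a⇔k (s≤s z≤n)))

funToFin-cong : ∀ {r n} (f g : Fin r → Fin n) → (∀ i → f i ≡ g i) → funToFin f ≡ funToFin g
funToFin-cong {zero}  f g _   = refl
funToFin-cong {suc r} f g f≗g =
  cong₂ F.combine (f≗g F.zero) (funToFin-cong (f ∘ F.suc) (g ∘ F.suc) (f≗g ∘ F.suc))

funToFin-injective : ∀ {r n} (f g : Fin r → Fin n) → funToFin f ≡ funToFin g → ∀ i → f i ≡ g i
funToFin-injective f g f≡g i = begin
  f i                      ≡⟨ FP.finToFun-funToFin f i ⟨
  finToFun (funToFin f) i  ≡⟨ cong (λ k → finToFun k i) f≡g ⟩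
  finToFun (funToFin g) i  ≡⟨ FP.finToFun-funToFin g i ⟩
  g i                      ∎
  where open ≡-Reasoning

module PowerGraph (m : ℕ) .{{_ : NonZero m}} where

  vertex : ℕ → Fin m
  vertex x = fromℕ< (m%n<n x m)

  toℕ-vertex : ∀ x → toℕ (vertex x) ≡ x % m
  toℕ-vertex x = FP.toℕ-fromℕ< _

  vertex-cong : ∀ x y → x % m ≡ y % m → vertex x ≡ vertex y
  vertex-cong x y x≡y = FP.toℕ-injective (trans (toℕ-vertex x) (trans x≡y (sym (toℕ-vertex y))))

  vertex-toℕ : ∀ a → vertex (toℕ a) ≡ a
  vertex-toℕ a = FP.toℕ-injective (trans (toℕ-vertex (toℕ a)) (m<n⇒m%n≡m (FP.toℕ<n a)))

  ∣-residue : ∀ {q} → q ∣ m → ∀ x {b : Fin m} → toℕ b ≡ x % m → q ∣ toℕ b ⇔ q ∣ x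
  ∣-residue q∣m x b≡x = mk⇔
    (λ q∣b → ∣n∣m%n⇒∣m q∣m (subst (_ ∣_) b≡x q∣b))
    (λ q∣x → subst (_ ∣_) (sym b≡x) (%-presˡ-∣ q∣x q∣m))

  -- An edge a^i — a^(i+1) preserves divisibility by every prime divisor of m,
  -- since both sides are divisible by q exactly when a is.
  edge-preserves-divisor : ∀ {q} → Prime q → q ∣ m → ∀ {b c} → SeqPowEdge m b c →
                           q ∣ toℕ b ⇔ q ∣ toℕ c
  edge-preserves-divisor pq q∣m (a , i , 1≤i , b≡aⁱ , c≡aⁱ⁺¹) = mk⇔
    (λ q∣b → from c⇔ (∣⇒∣^ (toℕ a) (suc i) (s≤s z≤n) (prime∣^⇒∣ pq _ i (to b⇔ q∣b))))
    (λ q∣c → from b⇔ (∣⇒∣^ (toℕ a) i 1≤i (prime∣^⇒∣ pq _ (suc i) (to c⇔ q∣c))))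
    where
    b⇔ = ∣-residue q∣m _ b≡aⁱ
    c⇔ = ∣-residue q∣m _ c≡aⁱ⁺¹

  connected-to-power : ∀ a j → 1 ≤ j → Connected m a (vertex (toℕ a ^ j))
  connected-to-power a (suc zero) _ =
    subst (Connected m a) (sym (trans (cong vertex (*-identityʳ (toℕ a))) (vertex-toℕ a)))
          (Closure.reflexive (SeqPowEdge m))
  connected-to-power a (suc (suc j)) _ =
    Closure.transitive (SeqPowEdge m) (connected-to-power a (suc j) (s≤s z≤n))
      (Closure.return (a , suc j , s≤s z≤n , toℕ-vertex _ , toℕ-vertex _))

module Components (m r : ℕ) .{{_ : NonZero m}} (p e : Fin r → ℕ)
  (p-prime : ∀ i → Prime (p i)) (p-injective : Injective _≡_ _≡_ p) (e≥1 : ∀ i → 1 ≤ e i)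
  (m≡∏ : m ≡ ∏ r (λ i → p i ^ e i)) where

  open PowerGraph m

  instance
    prime-power-nonZero : ∀ {i} → NonZero (p i ^ e i)
    prime-power-nonZero {i} = m^n≢0 (p i) (e i) {{prime⇒nonZero (p-prime i)}}

  prime-power∣m : ∀ i → p i ^ e i ∣ m
  prime-power∣m i = subst (p i ^ e i ∣_) (sym m≡∏) (factor∣∏ r (λ j → p j ^ e j) i)

  prime∣m : ∀ i → p i ∣ m
  prime∣m i = ∣-trans (∣⇒∣^ (p i) (e i) (e≥1 i) ∣-refl) (prime-power∣m i)

  pattern-bits : Fin m → Fin r → Fin 2
  pattern-bits x i = bit (p i ∣? toℕ x)

  component : Fin m → Fin (2 ^ r)
  component x = funToFin (pattern-bits x)

  same-component⇔ : ∀ x y → component x ≡ component y → ∀ i → p i ∣ toℕ x ⇔ p i ∣ toℕ y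
  same-component⇔ x y same i =
    bit-injective (p i ∣? toℕ x) (p i ∣? toℕ y)
      (funToFin-injective (pattern-bits x) (pattern-bits y) same i)

  connected⇒same-component : ∀ x y → Connected m x y → component x ≡ component y
  connected⇒same-component x y = Closure.gfold isEquivalence component λ {b} {c} edge →
    funToFin-cong (pattern-bits b) (pattern-bits c) λ i →
      bit-cong (p i ∣? toℕ b) (p i ∣? toℕ c)
        (edge-preserves-divisor (p-prime i) (prime∣m i) edge)

  K : ℕ
  K = m !

  power-determined : ∀ u v → (∀ i → p i ∣ u ⇔ p i ∣ v) → (u ^ K) % m ≡ (v ^ K) % m
  power-determined u v same = %≡%-lift m (λ i → p i ^ e i) (λ _ → prime-power-nonZero) ∏∣ _ _
    λ i → FactorialPower.determined (p-prime i) (e i) m (∣⇒≤ (prime-power∣m i)) u v (same i)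
    where
    ∏∣ : ∀ c → (∀ i → p i ^ e i ∣ c) → m ∣ c
    ∏∣ c divs = subst (_∣ c) (sym m≡∏) (prime-powers-∏-∣ r p e p-prime p-injective c divs)

  -- Vertices with equal patterns are connected: x — x^K = y^K — y.
  same-component⇒connected : ∀ x y → component x ≡ component y → Connected m x y
  same-component⇒connected x y same =
    Closure.transitive (SeqPowEdge m) (connected-to-power x K (1≤n! m))
      (subst (λ z → Connected m z y)
             (vertex-cong _ _ (power-determined (toℕ y) (toℕ x) λ i → ⇔-sym (same-component⇔ x y same i)))
             (Closure.symmetric (SeqPowEdge m) (connected-to-power y K (1≤n! m))))

  component-surjective : Surjective _≡_ _≡_ component
  component-surjective k = vertex Q , λ { refl → realised }
    where
    selected : Fin r → Fin 2
    selected = finToFun k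
    Q : ℕ
    Q = ∏ r (λ j → p j ^ toℕ (selected j))
    p∣Q⇔selected : ∀ i → p i ∣ Q ⇔ (1 ≤ toℕ (selected i))
    p∣Q⇔selected i = mk⇔
      (λ pᵢ∣Q → let (j , pᵢ∣pⱼˢ) = prime∣∏ (p-prime i) r _ pᵢ∣Q in
        subst (λ j → 1 ≤ toℕ (selected j))
              (sym (prime-power-index p p-prime p-injective (toℕ (selected j)) pᵢ∣pⱼˢ))
              (prime∣^⇒exponent≥1 (p-prime i) (p j) (toℕ (selected j)) pᵢ∣pⱼˢ))
      (λ sel → ∣-trans (∣⇒∣^ (p i) _ sel ∣-refl) (factor∣∏ r _ i))
    realised : component (vertex Q) ≡ k
    realised = trans
      (funToFin-cong (pattern-bits (vertex Q)) selected λ i →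
        bit-spec (p i ∣? toℕ (vertex Q)) (selected i)
          (p∣Q⇔selected i ⇔-∘ ∣-residue (prime∣m i) Q (toℕ-vertex Q)))
      (FP.funToFin-finToFin {r} {2} k)

-- The component map is onto Fin 2^r and its fibres are the components.
mainTheorem3 : (m r : ℕ) .{{_ : NonZero m}} (p e : Fin r → ℕ) →
    1 ≤ r → (∀ i → Prime (p i)) → Injective _≡_ _≡_ p → (∀ i → 1 ≤ e i) →
    m ≡ ∏ r (λ i → p i ^ e i) →
    HasExactlyComponents m (2 ^ r)
mainTheorem3 m r p e _ p-prime p-injective e≥1 m≡∏ =
  component , component-surjective ,
  λ x y → mk⇔ (same-component⇒connected x y) (connected⇒same-component x y)
  where open Components m r p e p-prime p-injective e≥1 m≡∏
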